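{- Let $n\ge 2$ be a power of $2$, let $M$ be a Boolean $n\times n$ matrix and $u,v\in\{0,1\}^n$, and let $G$ be the graph constructed below. Then $uMv=1$ if and only if $\mathrm{dist}_G(s,t)\le 4\log_2 n+3$. Moreover, $G$ is bipartite.
   Context: $uMv$ denotes the Boolean product $\bigvee_{i,j}(u_i\wedge M_{ij}\wedge v_j)$. All binary trees below are complete binary trees of depth $\log_2 n$ (so each has $n$ leaves). The graph $G$ consists of: (1) one such tree with root $s$, whose leaves are labelled $L_2[1],\dots,L_2[n]$; (2) $n$ such trees, the $i$-th with root $L_3[i]$ and leaves $L_4[i,1],\dots,L_4[i,n]$; (3) a disjoint copy of (1) and (2) with root $t$, leaves $R_2[j]$, roots $R_3[j]$ and leaves $R_4[j,i]$; (4) the edge $(L_4[i,j],R_4[j,i])$ for every $i,j$ with $M_{ij}=1$; (5) the edge $(L_2[i],L_3[i])$ for every $i$ with $u_i=1$; (6) the edge $(R_2[j],R_3[j])$ for every $j$ with $v_j=1$. The graph has $4n^2+2n-2$ nodes. -}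

module Defs where

open import Data.Nat using (ℕ; zero; suc; _+_; _*_; _^_; _≤_; _<_)
open import Data.Fin using (Fin; toℕ)
open import Data.Bool using (Bool; true; false; _∧_)
open import Data.List using (List; allFin)
open import Data.Bool.ListAction using (any)
open import Data.Product using (Σ; ∃; _×_; _,_)
open import Data.Sum using (_⊎_)
open import Relation.Binary.PropositionalEquality using (_≡_; _≢_)

-- Throughout, n = 2 ^ k, so log₂ n = k and every tree has depth k.

bprod : {n : ℕ} → (Fin n → Bool) → (Fin n → Fin n → Bool) → (Fin n → Bool) → Bool
bprod {n} u M v = any (λ i → any (λ j → u i ∧ M i j ∧ v j) (allFin n)) (allFin n)

record TNode (k : ℕ) : Set where
  constructor tnode
  field
    depth : ℕ
    pos   : ℕ
    depth≤ : depth ≤ k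
    pos<   : pos < 2 ^ depth

open TNode public

TreeEdge : {k : ℕ} → TNode k → TNode k → Set
TreeEdge x y = (depth y ≡ suc (depth x)) × ((pos y ≡ 2 * pos x) ⊎ (pos y ≡ 2 * pos x + 1))

IsRoot : {k : ℕ} → TNode k → Set
IsRoot x = (depth x ≡ 0) × (pos x ≡ 0)

IsLeaf : {k : ℕ} → TNode k → Fin (2 ^ k) → Set
IsLeaf {k} x j = (depth x ≡ k) × (pos x ≡ toℕ j)

-- Vertices of G (n = 2^k):
--   Ltop x   : node x of the tree rooted at s (leaves L₂[·])
--   Lsub i x : node x of the i-th tree rooted at L₃[i] (leaves L₄[i,·])
--   Rtop x   : node x of the tree rooted at t (leaves R₂[·])
--   Rsub j x : node x of the j-th tree rooted at R₃[j] (leaves R₄[j,·])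
data V (k : ℕ) : Set where
  Ltop : TNode k → V k
  Lsub : Fin (2 ^ k) → TNode k → V k
  Rtop : TNode k → V k
  Rsub : Fin (2 ^ k) → TNode k → V k

root : {k : ℕ} → TNode k
root = tnode 0 0 Data.Nat.z≤n (Data.Nat.s≤s Data.Nat.z≤n)

s t : (k : ℕ) → V k
s k = Ltop root
t k = Rtop root

-- Edges of G (each undirected edge listed once, in one orientation)
data Edge (k : ℕ) (M : Fin (2 ^ k) → Fin (2 ^ k) → Bool) (u v : Fin (2 ^ k) → Bool)
          : V k → V k → Set where
  ltop : ∀ {x y} → TreeEdge x y → Edge k M u v (Ltop x) (Ltop y)
  lsub : ∀ {i x y} → TreeEdge x y → Edge k M u v (Lsub i x) (Lsub i y)
  rtop : ∀ {x y} → TreeEdge x y → Edge k M u v (Rtop x) (Rtop y)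
  rsub : ∀ {j x y} → TreeEdge x y → Edge k M u v (Rsub j x) (Rsub j y)
  mid  : ∀ {i j x y} → IsLeaf x j → IsLeaf y i → M i j ≡ true →
         Edge k M u v (Lsub i x) (Rsub j y)
  uedge : ∀ {i x y} → IsLeaf x i → IsRoot y → u i ≡ true →
          Edge k M u v (Ltop x) (Lsub i y)
  vedge : ∀ {j x y} → IsLeaf x j → IsRoot y → v j ≡ true →
          Edge k M u v (Rtop x) (Rsub j y)

Adj : (k : ℕ) (M : Fin (2 ^ k) → Fin (2 ^ k) → Bool) (u v : Fin (2 ^ k) → Bool) →
      V k → V k → Set
Adj k M u v a b = Edge k M u v a b ⊎ Edge k M u v b a

data Walk (k : ℕ) (M : Fin (2 ^ k) → Fin (2 ^ k) → Bool) (u v : Fin (2 ^ k) → Bool)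
          : V k → V k → ℕ → Set where
  [] : ∀ {a} → Walk k M u v a a 0
  _∷_ : ∀ {a b c m} → Adj k M u v a b → Walk k M u v b c m → Walk k M u v a c (suc m)

DistLE : (k : ℕ) (M : Fin (2 ^ k) → Fin (2 ^ k) → Bool) (u v : Fin (2 ^ k) → Bool) →
         V k → V k → ℕ → Set
DistLE k M u v a b D = ∃ λ m → (m ≤ D) × Walk k M u v a b m

Bipartite : (k : ℕ) (M : Fin (2 ^ k) → Fin (2 ^ k) → Bool) (u v : Fin (2 ^ k) → Bool) → Set
Bipartite k M u v = Σ (V k → Bool) λ c → ∀ a b → Adj k M u v a b → c a ≢ c b

-- Let the level of a vertex be its distance to t along the intended route
-- s ⇝ L₂[i] → L₃[i] ⇝ L₄[i,j] → R₄[j,i] ⇝ R₃[j] → R₂[j] ⇝ t. Every edge of G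
-- changes the level by exactly one, so colouring by the parity of the level
-- shows that G is bipartite, and every walk from a vertex to t is at least as
-- long as its level. The level of s is 4k+3, so a walk from s to t of length at
-- most 4k+3 must descend at each step; descending from s it can only pass
-- through a u-edge (L₂[i],L₃[i]), an M-edge (L₄[i,j],R₄[j,i]) and a v-edge
-- (R₂[j],R₃[j]) in this order, which witnesses u i ∧ M i j ∧ v j. Conversely
-- such a witness gives the intended route, of length 4k+3.
module Submission where

open import Defs
open import Data.Nat using (ℕ; zero; suc; _+_; _*_; _^_; _≤_; _<_; _∸_; ⌊_/2⌋; z≤n; s≤s)
open import Data.Nat.Properties
open import Data.Fin using (Fin; toℕ)
open import Data.Fin.Properties using (toℕ<n)
open import Data.Bool using (Bool; true; false; not; _∧_)
open import Data.Bool.Properties using (T-≡; not-¬)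
open import Data.Bool.ListAction using (any)
open import Data.List using (allFin)
open import Data.List.Membership.Propositional using (lose)
open import Data.List.Membership.Propositional.Properties using (∈-allFin)
open import Data.List.Relation.Unary.Any using (satisfied)
open import Data.List.Relation.Unary.Any.Properties using (any⁺; any⁻)
open import Data.Product using (_×_; _,_; ∃; ∃₂; map₂)
open import Data.Sum using (_⊎_; inj₁; inj₂; swap)
open import Data.Unit using (⊤; tt)
open import Data.Empty using (⊥-elim)
open import Function.Bundles using (_⇔_; mk⇔; Equivalence)
open import Relation.Binary.PropositionalEquality

any-allFin⁺ : ∀ {n} (p : Fin n → Bool) (i : Fin n) → p i ≡ true → any p (allFin n) ≡ true
any-allFin⁺ p i pi =
  Equivalence.to T-≡ (any⁺ p (lose (∈-allFin i) (Equivalence.from T-≡ pi)))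

any-allFin⁻ : ∀ {n} (p : Fin n → Bool) → any p (allFin n) ≡ true → ∃ λ i → p i ≡ true
any-allFin⁻ p e =
  map₂ (Equivalence.to T-≡) (satisfied (any⁻ p (allFin _) (Equivalence.from T-≡ e)))

∧-true⁻ : ∀ a b → a ∧ b ≡ true → a ≡ true × b ≡ true
∧-true⁻ true true _ = refl , refl

bprod-true⇔ : ∀ {n} (u : Fin n → Bool) (M : Fin n → Fin n → Bool) (v : Fin n → Bool) →
  bprod u M v ≡ true ⇔ ∃₂ λ i j → u i ≡ true × M i j ≡ true × v j ≡ true
bprod-true⇔ u M v = mk⇔ witness product
  where
  witness : bprod u M v ≡ true → ∃₂ λ i j → u i ≡ true × M i j ≡ true × v j ≡ true
  witness e with any-allFin⁻ _ e
  ... | i , eᵢ with any-allFin⁻ _ eᵢ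
  ... | j , eᵢⱼ with ∧-true⁻ (u i) _ eᵢⱼ
  ... | uᵢ , eₘ with ∧-true⁻ (M i j) _ eₘ
  ... | mᵢⱼ , vⱼ = i , j , uᵢ , mᵢⱼ , vⱼ

  product : (∃₂ λ i j → u i ≡ true × M i j ≡ true × v j ≡ true) → bprod u M v ≡ true
  product (i , j , uᵢ , mᵢⱼ , vⱼ) =
    any-allFin⁺ _ i (any-allFin⁺ _ j (cong₂ _∧_ uᵢ (cong₂ _∧_ mᵢⱼ vⱼ)))

⌊n/2⌋-split : ∀ n → n ≡ 2 * ⌊ n /2⌋ ⊎ n ≡ 2 * ⌊ n /2⌋ + 1
⌊n/2⌋-split zero = inj₁ refl
⌊n/2⌋-split (suc zero) = inj₂ refl
⌊n/2⌋-split (suc (suc n)) with ⌊n/2⌋-split n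
... | inj₁ e = inj₁ (cong suc (trans (cong suc e) (sym (+-suc ⌊ n /2⌋ (⌊ n /2⌋ + 0)))))
... | inj₂ e = inj₂ (cong suc (trans (cong suc e) (cong (_+ 1) (sym (+-suc ⌊ n /2⌋ (⌊ n /2⌋ + 0))))))

2*⌊n/2⌋≤n : ∀ n → 2 * ⌊ n /2⌋ ≤ n
2*⌊n/2⌋≤n n with ⌊n/2⌋-split n
... | inj₁ e = ≤-reflexive (sym e)
... | inj₂ e = ≤-trans (n≤1+n _) (≤-reflexive (trans (+-comm 1 _) (sym e)))

⌊n/2⌋<m : ∀ {n m} → n < 2 * m → ⌊ n /2⌋ < m
⌊n/2⌋<m {n} {m} n<2m = *-cancelˡ-< 2 _ _ (≤-<-trans (2*⌊n/2⌋≤n n) n<2m)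

parity : ℕ → Bool
parity zero = false
parity (suc n) = not (parity n)

parity-suc≢ : ∀ {m n} → m ≡ suc n → parity m ≢ parity n
parity-suc≢ refl eq = not-¬ refl (sym eq)

route-length : ∀ k → k + suc (k + suc (k + suc k)) ≡ 4 * k + 3
route-length = solve-∀
  where open import Data.Nat.Tactic.RingSolver

module _ (k : ℕ) (M : Fin (2 ^ k) → Fin (2 ^ k) → Bool) (u v : Fin (2 ^ k) → Bool) where

  private
    W = Walk k M u v
    E = Edge k M u v
    A = Adj k M u v

  _++ʷ_ : ∀ {a b c m n} → W a b m → W b c n → W a c (m + n)
  [] ++ʷ w = w
  (e ∷ w) ++ʷ w′ = e ∷ (w ++ʷ w′)

  _∷ʳ_ : ∀ {a b c m} → W a b m → A b c → W a c (suc m)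
  [] ∷ʳ e = e ∷ []
  (e′ ∷ w) ∷ʳ e = e′ ∷ (w ∷ʳ e)

  reverse : ∀ {a b m} → W a b m → W b a m
  reverse [] = []
  reverse (e ∷ w) = reverse w ∷ʳ swap e

  toRoot : (f : TNode k → V k) → (∀ {x y} → TreeEdge x y → E (f x) (f y)) →
           (x : TNode k) → W (f x) (f root) (depth x)
  toRoot f edge (tnode d p d≤k p<) = up d p d≤k p<
    where
    up : ∀ d p (d≤k : d ≤ k) (p< : p < 2 ^ d) → W (f (tnode d p d≤k p<)) (f root) d
    up zero zero z≤n (s≤s z≤n) = []
    up (suc d) p d<k p< =
      inj₂ (edge (refl , ⌊n/2⌋-split p)) ∷ up d ⌊ p /2⌋ (<⇒≤ d<k) (⌊n/2⌋<m p<)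

  fromRoot : (f : TNode k → V k) → (∀ {x y} → TreeEdge x y → E (f x) (f y)) →
             (x : TNode k) → W (f root) (f x) (depth x)
  fromRoot f edge x = reverse (toRoot f edge x)

  leaf : Fin (2 ^ k) → TNode k
  leaf j = tnode k (toℕ j) ≤-refl (toℕ<n j)

  route : ∀ i j → u i ≡ true → M i j ≡ true → v j ≡ true →
          W (s k) (t k) (k + suc (k + suc (k + suc k)))
  route i j uᵢ mᵢⱼ vⱼ =
    fromRoot Ltop ltop (leaf i) ++ʷ
    (inj₁ (uedge (refl , refl) (refl , refl) uᵢ) ∷
    (fromRoot (Lsub i) lsub (leaf j) ++ʷ
    (inj₁ (mid {x = leaf j} {y = leaf i} (refl , refl) (refl , refl) mᵢⱼ) ∷
    (toRoot (Rsub j) rsub (leaf i) ++ʷ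
    (inj₂ (vedge {x = leaf j} (refl , refl) (refl , refl) vⱼ) ∷
    toRoot Rtop rtop (leaf j))))))

  height : TNode k → ℕ
  height x = k ∸ depth x

  height-step : ∀ {x y} → TreeEdge x y → height x ≡ suc (height y)
  height-step {x} {y} (dy , _) rewrite dy = +-∸-assoc 1 (subst (_≤ k) dy (depth≤ y))

  level : V k → ℕ
  level (Rtop x) = depth x
  level (Rsub j x) = depth x + suc k
  level (Lsub i x) = height x + suc (k + suc k)
  level (Ltop x) = height x + suc (k + suc (k + suc k))

  mid-level : ∀ {i j x y} → IsLeaf x j → IsLeaf y i → level (Lsub i x) ≡ suc (level (Rsub j y))
  mid-level (dx , _) (dy , _) rewrite dx | dy | n∸n≡0 k = refl

  uedge-level : ∀ {i x y} → IsLeaf x i → IsRoot y → level (Ltop x) ≡ suc (level (Lsub i y))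
  uedge-level (dx , _) (dy , _) rewrite dx | dy | n∸n≡0 k = refl

  Edge-level : ∀ {a b} → E a b → level a ≡ suc (level b) ⊎ level b ≡ suc (level a)
  Edge-level (ltop {x} {y} e) = inj₁ (cong (_+ suc (k + suc (k + suc k))) (height-step {x} {y} e))
  Edge-level (lsub {x = x} {y} e) = inj₁ (cong (_+ suc (k + suc k)) (height-step {x} {y} e))
  Edge-level (rtop (dy , _)) = inj₂ dy
  Edge-level (rsub (dy , _)) = inj₂ (cong (_+ suc k) dy)
  Edge-level (mid {i} {j} {x} {y} lx ly _) = inj₁ (mid-level {i} {j} {x} {y} lx ly)
  Edge-level (uedge {i} {x} {y} lx ry _) = inj₁ (uedge-level {i} {x} {y} lx ry)
  Edge-level (vedge (dx , _) (dy , _) _) rewrite dx | dy = inj₂ refl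

  Adj-level : ∀ {a b} → A a b → level a ≡ suc (level b) ⊎ level b ≡ suc (level a)
  Adj-level (inj₁ e) = Edge-level e
  Adj-level (inj₂ e) = swap (Edge-level e)

  Adj-level≤ : ∀ {a b} → A a b → level a ≤ suc (level b)
  Adj-level≤ {a} e with Adj-level e
  ... | inj₁ q = ≤-reflexive q
  ... | inj₂ q = subst (λ l → level a ≤ suc l) (sym q) (m≤n⇒m≤1+n (n≤1+n _))

  level≤length : ∀ {a m} → W a (t k) m → level a ≤ m
  level≤length [] = z≤n
  level≤length (e ∷ w) = ≤-trans (Adj-level≤ e) (s≤s (level≤length w))

  -- The part of the product uMv that a walk from the vertex to t must still witness.
  Pending : V k → Set
  Pending (Ltop _) = bprod u M v ≡ true
  Pending (Lsub i _) = ∃ λ j → M i j ≡ true × v j ≡ true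
  Pending (Rsub j _) = v j ≡ true
  Pending (Rtop _) = ⊤

  Pending-descend : ∀ {a b} → A a b → suc (level b) ≤ level a → Pending b → Pending a
  Pending-descend (inj₁ (ltop _)) _ p = p
  Pending-descend (inj₂ (ltop _)) _ p = p
  Pending-descend (inj₁ (lsub _)) _ p = p
  Pending-descend (inj₂ (lsub _)) _ p = p
  Pending-descend (inj₁ (rtop _)) _ p = p
  Pending-descend (inj₂ (rtop _)) _ p = p
  Pending-descend (inj₁ (rsub _)) _ p = p
  Pending-descend (inj₂ (rsub _)) _ p = p
  Pending-descend (inj₁ (mid {j = j} _ _ mᵢⱼ)) _ vⱼ = j , mᵢⱼ , vⱼ
  Pending-descend (inj₂ (mid {i} {j} {x} {y} lx ly _)) descends _ =
    ⊥-elim (<-asym (≤-reflexive (sym (mid-level {i} {j} {x} {y} lx ly))) descends)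
  Pending-descend (inj₁ (uedge {i = i} _ _ uᵢ)) _ (j , mᵢⱼ , vⱼ) =
    Equivalence.from (bprod-true⇔ u M v) (i , j , uᵢ , mᵢⱼ , vⱼ)
  Pending-descend (inj₂ (uedge {i} {x} {y} lx ry _)) descends _ =
    ⊥-elim (<-asym (≤-reflexive (sym (uedge-level {i} {x} {y} lx ry))) descends)
  Pending-descend (inj₁ (vedge _ _ _)) _ _ = tt
  Pending-descend (inj₂ (vedge _ _ vⱼ)) _ _ = vⱼ

  shortest-walk-Pending : ∀ {a m} → W a (t k) m → m ≤ level a → Pending a
  shortest-walk-Pending [] _ = tt
  shortest-walk-Pending (e ∷ w) m≤level =
    Pending-descend e (≤-trans (s≤s (level≤length w)) m≤level)
      (shortest-walk-Pending w (≤-pred (≤-trans m≤level (Adj-level≤ e))))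

  bipartite : Bipartite k M u v
  bipartite = (λ a → parity (level a)) , adjacent-parity
    where
    adjacent-parity : ∀ a b → A a b → parity (level a) ≢ parity (level b)
    adjacent-parity a b e with Adj-level e
    ... | inj₁ q = parity-suc≢ q
    ... | inj₂ q = λ eq → parity-suc≢ q (sym eq)

lemma30 : (k : ℕ) → 1 ≤ k →
    (M : Fin (2 ^ k) → Fin (2 ^ k) → Bool) (u v : Fin (2 ^ k) → Bool) →
    ((bprod u M v ≡ true) ⇔ DistLE k M u v (s k) (t k) (4 * k + 3)) × Bipartite k M u v
lemma30 k _ M u v = mk⇔ short-route shortest-walk , bipartite k M u v
  where
  short-route : bprod u M v ≡ true → DistLE k M u v (s k) (t k) (4 * k + 3)
  short-route e with Equivalence.to (bprod-true⇔ u M v) e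
  ... | i , j , uᵢ , mᵢⱼ , vⱼ = _ , ≤-reflexive (route-length k) , route k M u v i j uᵢ mᵢⱼ vⱼ

  shortest-walk : DistLE k M u v (s k) (t k) (4 * k + 3) → bprod u M v ≡ true
  shortest-walk (m , m≤ , w) =
    shortest-walk-Pending k M u v w (≤-trans m≤ (≤-reflexive (sym (route-length k))))
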